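{- Let $b,\phi,\hat\phi,c,\delta\in(0,1)$ with $c\le1/6$, $\phi\le b$, $b\le c$, $\delta\le c^2b/\log n$ and $\phi\le\hat\phi\le\phi/b$. Let $G=(V,E)$ be an $n$-vertex graph, fix a cluster $U\subseteq V$, and let $H=(V,E',w)$ be a weighted subgraph of $G$ with $H[U]\approx_\delta G[U]$. Then every cut $\emptyset\ne S\subsetneq U$ with $\Phi^\circ_U(S)\ge\hat\phi$ satisfies $\Phi^\circ_{H,U}(S)\ge(1-\frac1{3\log n})\hat\phi$.
   Context: $\log$ is base 2. $E(A,B)$ is the set of edges of $G$ between $A$ and $B$ and $\mathrm{vol}(S)$ the sum of degrees in $G$; $w(A,B)$ is the total weight of edges of $H$ between $A$ and $B$ and $\mathrm{vol}_H(S)$ the sum of weighted degrees in $H$. $H[U]\approx_\delta G[U]$ means: for all $S\subseteq U$, $\big|w(S,U\setminus S)-|E(S,U\setminus S)|\big|\le\delta|E(S,V\setminus S)|$, and for all $S\subseteq V$, $(1-\delta)|E(S,V\setminus S)|\le w(S,V\setminus S)\le(1+\delta)|E(S,V\setminus S)|$. For $S\subseteq U$: $\mathrm{vol}^\circ_U(S)=\mathrm{vol}(S)+\frac{b-\phi}\phi|E(S,V\setminus U)|$ and $\mathrm{vol}^\circ_{H,U}(S)=\mathrm{vol}_H(S)+\frac{b-\phi}\phi w(S,V\setminus U)$; for $\emptyset\ne S\subsetneq U$, $\Phi^\circ_U(S)=|E(S,U\setminus S)|/\min\{\mathrm{vol}^\circ_U(S),\mathrm{vol}^\circ_U(U\setminus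 S)\}$ and $\Phi^\circ_{H,U}(S)=w(S,U\setminus S)/\min\{\mathrm{vol}^\circ_{H,U}(S),\mathrm{vol}^\circ_{H,U}(U\setminus S)\}$.
   Formalization: The parameters b, φ, φ̂, c, δ range over the rationals in (0,1), and the edge weights of H are rational. -}

module Defs where

open import Data.Bool.Base using (Bool; true; false; if_then_else_)
open import Data.Nat.Base as ℕ using (ℕ; zero; suc)
open import Data.Integer.Base as ℤ using (ℤ; +_; -[1+_])
open import Data.Rational.Base
  using (ℚ; 0ℚ; 1ℚ; _+_; _*_; _-_; _⊓_; 1/_; ≢-nonZero; ↥_; ↧ₙ_; _≤_; _<_; ∣_∣)
open import Data.Rational.Properties using (_≟_)
open import Data.Fin.Base using (Fin)
open import Data.Fin.Subset using (Subset; ∁; _∩_; ⊤)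
open import Data.Vec.Base using (lookup)
open import Data.List.Base using (foldr; map; allFin)
open import Relation.Nullary using (yes; no; ¬_)
open import Relation.Binary.PropositionalEquality using (_≡_)

Σ : {n : ℕ} → (Fin n → ℚ) → ℚ
Σ {n} f = foldr _+_ 0ℚ (map f (allFin n))

[_] : Bool → ℚ
[ b ] = if b then 1ℚ else 0ℚ

-- Total division: x / y, and (by convention) 0 when y = 0.
-- (Φ° is only defined by the paper when the denominator is nonzero.)
_÷₀_ : ℚ → ℚ → ℚ
x ÷₀ y with y ≟ 0ℚ
... | yes _  = 0ℚ
... | no y≢0 = x * (1/ y) {{≢-nonZero y≢0}}

record Graph (n : ℕ) : Set where
  field
    adj   : Fin n → Fin n → Bool
    sym   : ∀ i j → adj i j ≡ adj j i
    irref : ∀ i → adj i i ≡ false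

-- A weighted subgraph H = (V, E', w) of G: symmetric nonnegative weights,
-- supported on edges of G (w i j ≠ 0 exactly on the edge set E' ⊆ E).
record WeightedSubgraph {n : ℕ} (G : Graph n) : Set where
  field
    wt      : Fin n → Fin n → ℚ
    sym     : ∀ i j → wt i j ≡ wt j i
    nonneg  : ∀ i j → 0ℚ ≤ wt i j
    support : ∀ i j → ¬ (wt i j ≡ 0ℚ) → Graph.adj G i j ≡ true

module _ {n : ℕ} (G : Graph n) where
  open Graph G

  -- |E(A,B)|: number of pairs (a,b), a ∈ A, b ∈ B, with ab an edge of G
  -- (used only for disjoint A, B).
  eG : Subset n → Subset n → ℚ
  eG A B = Σ λ i → Σ λ j → [ lookup A i ] * [ lookup B j ] * [ adj i j ]

  volG : Subset n → ℚ
  volG S = Σ λ i → [ lookup S i ] * Σ λ j → [ adj i j ]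

module _ {n : ℕ} {G : Graph n} (H : WeightedSubgraph G) where
  open WeightedSubgraph H

  wH : Subset n → Subset n → ℚ
  wH A B = Σ λ i → Σ λ j → [ lookup A i ] * [ lookup B j ] * wt i j

  volH : Subset n → ℚ
  volH S = Σ λ i → [ lookup S i ] * Σ λ j → wt i j

_∖_ : {n : ℕ} → Subset n → Subset n → Subset n
A ∖ B = A ∩ ∁ B

module _ {n : ℕ} (b φ : ℚ) (G : Graph n) (U : Subset n) where

  private
    κ : ℚ
    κ = (b - φ) ÷₀ φ

  vol° : Subset n → ℚ
  vol° S = volG G S + κ * eG G S (∁ U)

  Φ° : Subset n → ℚ
  Φ° S = eG G S (U ∖ S) ÷₀ (vol° S ⊓ vol° (U ∖ S))

  module _ (H : WeightedSubgraph G) where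
    volH° : Subset n → ℚ
    volH° S = volH H S + κ * wH H S (∁ U)

    ΦH° : Subset n → ℚ
    ΦH° S = wH H S (U ∖ S) ÷₀ (volH° S ⊓ volH° (U ∖ S))

_[_]≈[_]_ : {n : ℕ} {G : Graph n} → WeightedSubgraph G → Subset n → ℚ → Graph n → Set
_[_]≈[_]_ {n} {G} H U δ _ =
  (∀ (S : Subset n) → (∀ {x} → lookup S x ≡ true → lookup U x ≡ true) →
     ∣ wH H S (U ∖ S) - eG G S (U ∖ S) ∣ ≤ δ * eG G S (∁ S))
  × (∀ (S : Subset n) →
     ((1ℚ - δ) * eG G S (∁ S) ≤ wH H S (∁ S))
     × (wH H S (∁ S) ≤ (1ℚ + δ) * eG G S (∁ S)))
  where open import Data.Product using (_×_)

pos neg : ℤ → ℕ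
pos (+ k)    = k
pos -[1+ k ] = 0
neg (+ k)    = 0
neg -[1+ k ] = suc k

-- n ^ A ≤ 2 ^ C for integer exponents A, C (n ≥ 1), cleared of negatives:
-- n^{A⁺} · 2^{C⁻} ≤ 2^{C⁺} · n^{A⁻}.
PowLe : ℕ → ℤ → ℤ → Set
PowLe n A C = n ℕ.^ pos A ℕ.* 2 ℕ.^ neg C ℕ.≤ 2 ℕ.^ pos C ℕ.* n ℕ.^ neg A

-- a · log₂ n ≤ c   (for rationals a, c and n ≥ 1).
-- Writing a = p/q, c = r/s (q, s > 0) this is (p·s)·log₂ n ≤ r·q,
-- i.e. n^(p·s) ≤ 2^(r·q).
_·log₂_≤_ : ℚ → ℕ → ℚ → Set
a ·log₂ n ≤ c =
  PowLe n ((↥ a) ℤ.* (+ (↧ₙ c))) ((↥ c) ℤ.* (+ (↧ₙ a)))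

{-# OPTIONS --safe #-}
module Submission where

-- Let T ∈ {S, U ∖ S} attain the minimum in the denominator of Φ°_U(S), and put e = |E(S, U∖S)|,
-- o = |E(T, V∖U)|, κ = (b - φ)/φ. The sparsifier conditions give w(S, U∖S) ≥ e - δ(e + o),
-- w(T, V∖U) ≤ o + 2δ(e + o) and vol_H(T) ≤ (1 + δ) vol(T). Together with φ̂ vol°_U(T) ≤ e and
-- b ≤ φ̂(1 + κ) ≤ 1 (from φ ≤ φ̂ ≤ φ/b) they yield φ̂ vol°_{H,U}(T) ≤ (1 + 4δ) e and b o ≤ e, hence
-- b Φ°_{H,U}(S) (1 + 4δ) ≥ φ̂ (b - bδ - δ), that is b (φ̂ - Φ°_{H,U}(S)) ≤ 6 φ̂ δ.
-- Multiplying by 3c² ≤ 1/12 and using δ log n ≤ c² b gives 3 (φ̂ - Φ°_{H,U}(S)) log n ≤ φ̂.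

open import Defs
open import Data.Nat.Base using (ℕ)
open import Data.Integer.Base using (+_)
open import Data.Rational.Base using (ℚ; 0ℚ; 1ℚ; _*_; _-_; _/_; _≤_; _<_)
open import Data.Fin.Subset using (Subset; Nonempty; _⊂_)
open import Data.Product using (_×_)

open import Algebra.Bundles using (CommutativeRing)
open import Data.Bool.Base using (true; false; not; _∧_)
import Data.Nat.Base as ℕ
import Data.Nat.Properties as ℕ
import Data.Integer.Base as ℤ
open import Data.Integer.Base using (+[1+_]; -[1+_])
import Data.Integer.Properties as ℤ
open import Data.Fin.Base using (Fin; zero; suc)
open import Data.Fin.Properties using (nonZeroIndex)
open import Data.Fin.Subset using (_⊆_; ∁; ⁅_⁆; ⊥)
open import Data.Fin.Subset.Properties using (p∩q⊆p)
open import Data.Vec.Base using (lookup; tabulate)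
import Data.Vec.Properties as Vecₚ
open import Data.List.Base using (foldr; map; allFin)
import Data.List.Base as List
import Data.List.Properties as Listₚ
open import Data.Product using (_,_; proj₁; proj₂)
open import Data.Sum using (_⊎_; inj₁; inj₂)
open import Data.Rational.Base
  using (_+_; -_; _⊓_; ∣_∣; NonZero; Positive; nonNegative; positive; ≢-nonZero; mkℚ; *<*)
open import Data.Rational.Properties
import Data.Rational.Unnormalised.Properties as ℚᵘ
open import Data.Rational.Solver using (module +-*-Solver)
open import Algebra.Properties.CommutativeMonoid.Sum +-0-commutativeMonoid
  using (sum; sum-cong-≗; ∑-distrib-+; ∑-comm; sum-replicate-zero)
open import Algebra.Properties.Semiring.Sum (CommutativeRing.semiring +-*-commutativeRing)
  using (*-distribˡ-sum)
open import Function.Base using (_∘_)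
open import Relation.Binary.PropositionalEquality hiding ([_])
open import Relation.Nullary using (yes; no; ¬_; contradiction)
import Algebra.Properties.CommutativeSemigroup as CommutativeSemigroupₚ
open import Data.Empty using (⊥-elim)
open +-*-Solver

-- Linear steps: the ring solver proves the equation between the differences.
≤-by-difference : ∀ {x y x′ y′} → y - x ≡ y′ - x′ → x′ ≤ y′ → x ≤ y
≤-by-difference {x} {y} {x′} {y′} eq x′≤y′ = begin
  x               ≡⟨ +-identityˡ x ⟨
  0ℚ + x          ≤⟨ +-monoˡ-≤ x 0≤y-x ⟩
  (y - x) + x     ≡⟨ solve 2 (λ x y → (y :- x) :+ x := y) refl x y ⟩
  y               ∎
  where
  open ≤-Reasoning
  0≤y-x : 0ℚ ≤ y - x
  0≤y-x = subst (0ℚ ≤_) (sym eq)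
            (subst (_≤ y′ - x′) (+-inverseʳ x′) (+-monoˡ-≤ (- x′) x′≤y′))

≤⇒0≤- : ∀ {x y} → x ≤ y → 0ℚ ≤ y - x
≤⇒0≤- {x} {y} = ≤-by-difference (solve 2 (λ x y → (y :- x) :- con 0ℚ := y :- x) refl x y)

+-nonNeg : ∀ {x y} → 0ℚ ≤ x → 0ℚ ≤ y → 0ℚ ≤ x + y
+-nonNeg {x} {y} 0≤x 0≤y = subst (_≤ x + y) (+-identityˡ 0ℚ) (+-mono-≤ 0≤x 0≤y)

*-monoˡ-≤-0≤ : ∀ {r p q} → 0ℚ ≤ r → p ≤ q → r * p ≤ r * q
*-monoˡ-≤-0≤ {r} 0≤r = *-monoˡ-≤-nonNeg r {{nonNegative 0≤r}}

*-monoʳ-≤-0≤ : ∀ {r p q} → 0ℚ ≤ r → p ≤ q → p * r ≤ q * r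
*-monoʳ-≤-0≤ {r} 0≤r = *-monoʳ-≤-nonNeg r {{nonNegative 0≤r}}

*-cancelˡ-≤-0< : ∀ {r p q} → 0ℚ < r → r * p ≤ r * q → p ≤ q
*-cancelˡ-≤-0< {r} 0<r = *-cancelˡ-≤-pos r {{positive 0<r}}

*-nonNeg : ∀ {x y} → 0ℚ ≤ x → 0ℚ ≤ y → 0ℚ ≤ x * y
*-nonNeg {x} {y} 0≤x 0≤y = subst (_≤ x * y) (*-zeroʳ x) (*-monoˡ-≤-0≤ 0≤x 0≤y)

*-pos : ∀ {x y} → 0ℚ < x → 0ℚ < y → 0ℚ < x * y
*-pos {x} {y} 0<x 0<y = positive⁻¹ (x * y) {{pos*pos⇒pos x {{positive 0<x}} y {{positive 0<y}}}}

-p≤∣p∣ : ∀ p → - p ≤ ∣ p ∣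
-p≤∣p∣ p with ∣p∣≡p∨∣p∣≡-p p
... | inj₁ ∣p∣≡p = ≤-trans (neg-antimono-≤ (∣p∣≡p⇒0≤p ∣p∣≡p)) (0≤∣p∣ p)
... | inj₂ ∣p∣≡-p = ≤-reflexive (sym ∣p∣≡-p)

÷₀-*-inverse : ∀ x y → (y ≡ 0ℚ → x ≡ 0ℚ) → (x ÷₀ y) * y ≡ x
÷₀-*-inverse x y y≡0⇒x≡0 with y ≟ 0ℚ
... | yes y≡0 = trans (*-zeroˡ y) (sym (y≡0⇒x≡0 y≡0))
... | no y≢0 = trans (*-assoc x _ y) (trans (cong (x *_) (*-inverseˡ y)) (*-identityʳ x))
  where
  instance
    y-nonZero : NonZero y
    y-nonZero = ≢-nonZero y≢0

0≤∧≢0⇒0< : ∀ {y} → 0ℚ ≤ y → ¬ (y ≡ 0ℚ) → 0ℚ < y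
0≤∧≢0⇒0< {y} 0≤y y≢0 = positive⁻¹ y {{nonNeg∧nonZero⇒pos y {{nonNegative 0≤y}} {{≢-nonZero y≢0}}}}

÷₀-nonNeg : ∀ {x y} → 0ℚ ≤ x → 0ℚ ≤ y → 0ℚ ≤ x ÷₀ y
÷₀-nonNeg {x} {y} 0≤x 0≤y with y ≟ 0ℚ
... | yes _ = ≤-refl
... | no y≢0 = *-nonNeg 0≤x (<⇒≤ (positive⁻¹ _ {{1/pos⇒pos y {{y-positive}}}}))
  where
  y-positive : Positive y
  y-positive = positive (0≤∧≢0⇒0< 0≤y y≢0)

0<≤÷₀⇒≢0 : ∀ {z x y} → 0ℚ < z → z ≤ x ÷₀ y → ¬ (y ≡ 0ℚ)
0<≤÷₀⇒≢0 {z} {x} {y} 0<z z≤x/y y≡0 with y ≟ 0ℚ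
... | yes _ = <-irrefl refl (<-≤-trans 0<z z≤x/y)
... | no y≢0 = y≢0 y≡0

≤÷₀⇒*≤ : ∀ {z x y} → z ≤ x ÷₀ y → 0ℚ < y → z * y ≤ x
≤÷₀⇒*≤ {z} {x} {y} z≤x/y 0<y =
  ≤-trans (*-monoʳ-≤-0≤ (<⇒≤ 0<y) z≤x/y) (≤-reflexive (÷₀-*-inverse x y (λ y≡0 → ⊥-elim (<⇒≢ 0<y (sym y≡0)))))

Σ≡sum : ∀ {n} (f : Fin n → ℚ) → Σ f ≡ sum f
Σ≡sum {ℕ.zero} f = refl
Σ≡sum {ℕ.suc n} f = cong (_+_ (f zero)) (begin
  foldr _+_ 0ℚ (map f (List.tabulate suc))  ≡⟨ cong (foldr _+_ 0ℚ) (Listₚ.map-tabulate suc f) ⟩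
  foldr _+_ 0ℚ (List.tabulate (f ∘ suc))    ≡⟨ cong (foldr _+_ 0ℚ) (Listₚ.map-tabulate (λ i → i) (f ∘ suc)) ⟨
  Σ (f ∘ suc)                               ≡⟨ Σ≡sum (f ∘ suc) ⟩
  sum (f ∘ suc)                             ∎)
  where open ≡-Reasoning

Σ-cong : ∀ {n} {f g : Fin n → ℚ} → (∀ i → f i ≡ g i) → Σ f ≡ Σ g
Σ-cong {n} f≗g = cong (foldr _+_ 0ℚ) (Listₚ.map-cong f≗g (allFin n))

Σ-+ : ∀ {n} (f g : Fin n → ℚ) → Σ (λ i → f i + g i) ≡ Σ f + Σ g
Σ-+ f g = begin
  Σ (λ i → f i + g i)   ≡⟨ Σ≡sum (λ i → f i + g i) ⟩
  sum (λ i → f i + g i) ≡⟨ ∑-distrib-+ f g ⟩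
  sum f + sum g         ≡⟨ cong₂ _+_ (Σ≡sum f) (Σ≡sum g) ⟨
  Σ f + Σ g             ∎
  where open ≡-Reasoning

Σ-*ˡ : ∀ {n} k (f : Fin n → ℚ) → Σ (λ i → k * f i) ≡ k * Σ f
Σ-*ˡ k f = begin
  Σ (λ i → k * f i)     ≡⟨ Σ≡sum (λ i → k * f i) ⟩
  sum (λ i → k * f i)   ≡⟨ *-distribˡ-sum k f ⟨
  k * sum f             ≡⟨ cong (k *_) (Σ≡sum f) ⟨
  k * Σ f               ∎
  where open ≡-Reasoning

Σ-comm : ∀ {n} (f : Fin n → Fin n → ℚ) → Σ (λ i → Σ (f i)) ≡ Σ (λ j → Σ (λ i → f i j))
Σ-comm f = begin
  Σ (λ i → Σ (f i))                   ≡⟨ trans (Σ-cong (λ i → Σ≡sum (f i))) (Σ≡sum (λ i → sum (f i))) ⟩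
  sum (λ i → sum (f i))               ≡⟨ ∑-comm f ⟩
  sum (λ j → sum (λ i → f i j))       ≡⟨ trans (Σ-cong (λ j → Σ≡sum (λ i → f i j))) (Σ≡sum (λ j → sum (λ i → f i j))) ⟨
  Σ (λ j → Σ (λ i → f i j))           ∎
  where open ≡-Reasoning

Σ-mono-≤ : ∀ {n} {f g : Fin n → ℚ} → (∀ i → f i ≤ g i) → Σ f ≤ Σ g
Σ-mono-≤ {f = f} {g} f≤g = subst₂ _≤_ (sym (Σ≡sum f)) (sym (Σ≡sum g)) (sum-mono-≤ f≤g)
  where
  sum-mono-≤ : ∀ {m} {f g : Fin m → ℚ} → (∀ i → f i ≤ g i) → sum f ≤ sum g
  sum-mono-≤ {ℕ.zero} _ = ≤-refl
  sum-mono-≤ {ℕ.suc m} f≤g = +-mono-≤ (f≤g zero) (sum-mono-≤ (f≤g ∘ suc))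

Σ-nonNeg : ∀ {n} {f : Fin n → ℚ} → (∀ i → 0ℚ ≤ f i) → 0ℚ ≤ Σ f
Σ-nonNeg {n} {f} 0≤f = subst (_≤ Σ f) (trans (Σ≡sum {n} (λ _ → 0ℚ)) (sum-replicate-zero n)) (Σ-mono-≤ 0≤f)

Σ-⁅⁆ : ∀ {n} (x : Fin n) (g : Fin n → ℚ) → Σ (λ i → [ lookup ⁅ x ⁆ i ] * g i) ≡ g x
Σ-⁅⁆ x g = trans (Σ≡sum (λ i → [ lookup ⁅ x ⁆ i ] * g i)) (sum-⁅⁆ x g)
  where
  sum-⁅⁆ : ∀ {m} (x : Fin m) (g : Fin m → ℚ) → sum (λ i → [ lookup ⁅ x ⁆ i ] * g i) ≡ g x
  sum-⁅⁆ {ℕ.suc m} zero g = begin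
    1ℚ * g zero + sum (λ i → [ lookup (⊥ {m}) i ] * g (suc i))
      ≡⟨ cong₂ _+_ (*-identityˡ (g zero)) (sum-cong-≗ λ i →
           trans (cong (λ t → [ t ] * g (suc i)) (Vecₚ.lookup-replicate i false)) (*-zeroˡ (g (suc i)))) ⟩
    g zero + sum {m} (λ _ → 0ℚ)  ≡⟨ cong (_+_ (g zero)) (sum-replicate-zero m) ⟩
    g zero + 0ℚ                  ≡⟨ +-identityʳ (g zero) ⟩
    g zero                       ∎
    where open ≡-Reasoning
  sum-⁅⁆ {ℕ.suc m} (suc x) g =
    trans (cong₂ _+_ (*-zeroˡ (g zero)) (sum-⁅⁆ x (g ∘ suc))) (+-identityˡ (g (suc x)))

⊆⇒lookup : ∀ {n} {S U : Subset n} → S ⊆ U → ∀ {x} → lookup S x ≡ true → lookup U x ≡ true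
⊆⇒lookup {S = S} S⊆U {x} x∈S = Vecₚ.[]=⇒lookup (S⊆U (Vecₚ.lookup⇒[]= x S x∈S))

lookup-∖ : ∀ {n} (A B : Subset n) i → lookup (A ∖ B) i ≡ lookup A i ∧ not (lookup B i)
lookup-∖ A B i = trans (Vecₚ.lookup-zipWith _∧_ i A (∁ B)) (cong (lookup A i ∧_) (Vecₚ.lookup-map i not B))

∧-not-∧-not : ∀ s u → (s ≡ true → u ≡ true) → u ∧ not (u ∧ not s) ≡ s
∧-not-∧-not false false _   = refl
∧-not-∧-not false true  _   = refl
∧-not-∧-not true  true  _   = refl
∧-not-∧-not true  false s⇒u = contradiction (s⇒u refl) λ ()

[not]≡[∧not]+[not] : ∀ t u → (t ≡ true → u ≡ true) → [ not t ] ≡ [ u ∧ not t ] + [ not u ]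
[not]≡[∧not]+[not] false false _   = refl
[not]≡[∧not]+[not] false true  _   = refl
[not]≡[∧not]+[not] true  true  _   = refl
[not]≡[∧not]+[not] true  false t⇒u = contradiction (t⇒u refl) λ ()

[not]+[]≡1 : ∀ t → [ not t ] + [ t ] ≡ 1ℚ
[not]+[]≡1 false = refl
[not]+[]≡1 true  = refl

[]-nonNeg : ∀ t → 0ℚ ≤ [ t ]
[]-nonNeg false = ≤-refl
[]-nonNeg true  = nonNegative⁻¹ 1ℚ

[]≤1 : ∀ t → [ t ] ≤ 1ℚ
[]≤1 false = nonNegative⁻¹ 1ℚ
[]≤1 true  = ≤-refl

∖-∖-⊆ : ∀ {n} {S U : Subset n} → S ⊆ U → U ∖ (U ∖ S) ≡ S
∖-∖-⊆ {S = S} {U} S⊆U = begin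
  U ∖ (U ∖ S)                         ≡⟨ Vecₚ.tabulate∘lookup (U ∖ (U ∖ S)) ⟨
  tabulate (lookup (U ∖ (U ∖ S)))     ≡⟨ Vecₚ.tabulate-cong pointwise ⟩
  tabulate (lookup S)                 ≡⟨ Vecₚ.tabulate∘lookup S ⟩
  S                                   ∎
  where
  open ≡-Reasoning
  pointwise : ∀ i → lookup (U ∖ (U ∖ S)) i ≡ lookup S i
  pointwise i = begin
    lookup (U ∖ (U ∖ S)) i                           ≡⟨ lookup-∖ U (U ∖ S) i ⟩
    lookup U i ∧ not (lookup (U ∖ S) i)              ≡⟨ cong (λ t → lookup U i ∧ not t) (lookup-∖ U S i) ⟩
    lookup U i ∧ not (lookup U i ∧ not (lookup S i)) ≡⟨ ∧-not-∧-not (lookup S i) (lookup U i) (⊆⇒lookup S⊆U) ⟩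
    lookup S i                                       ∎

[∁]-split : ∀ {n} {T U : Subset n} → T ⊆ U →
  ∀ j → [ lookup (∁ T) j ] ≡ [ lookup (U ∖ T) j ] + [ lookup (∁ U) j ]
[∁]-split {T = T} {U} T⊆U j = begin
  [ lookup (∁ T) j ]                              ≡⟨ cong [_] (Vecₚ.lookup-map j not T) ⟩
  [ not (lookup T j) ]                            ≡⟨ [not]≡[∧not]+[not] (lookup T j) (lookup U j) (⊆⇒lookup T⊆U) ⟩
  [ lookup U j ∧ not (lookup T j) ] + [ not (lookup U j) ]
    ≡⟨ cong₂ (λ s t → [ s ] + [ t ]) (lookup-∖ U T j) (Vecₚ.lookup-map j not U) ⟨
  [ lookup (U ∖ T) j ] + [ lookup (∁ U) j ]       ∎
  where open ≡-Reasoning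

-- eG G, volG G and wH H, volH H are, definitionally, cut and vol of adjacency G (below) and of the
-- weights of H.
module _ {n : ℕ} (f : Fin n → Fin n → ℚ) where

  cut : Subset n → Subset n → ℚ
  cut A B = Σ λ i → Σ λ j → [ lookup A i ] * [ lookup B j ] * f i j

  vol : Subset n → ℚ
  vol A = Σ λ i → [ lookup A i ] * Σ (f i)

module _ {n : ℕ} (f : Fin n → Fin n → ℚ) where

  cut-by-rows : ∀ A B → cut f A B ≡ Σ λ i → [ lookup A i ] * Σ λ j → [ lookup B j ] * f i j
  cut-by-rows A B = Σ-cong λ i → trans (Σ-cong λ j → *-assoc [ lookup A i ] [ lookup B j ] (f i j))
                                       (Σ-*ˡ [ lookup A i ] (λ j → [ lookup B j ] * f i j))

  cut-splitʳ : ∀ A B B₁ B₂ → (∀ j → [ lookup B j ] ≡ [ lookup B₁ j ] + [ lookup B₂ j ]) →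
    cut f A B ≡ cut f A B₁ + cut f A B₂
  cut-splitʳ A B B₁ B₂ split =
    trans (Σ-cong λ i → trans (Σ-cong (distrib i)) (Σ-+ (part B₁ i) (part B₂ i)))
          (Σ-+ (λ i → Σ (part B₁ i)) (λ i → Σ (part B₂ i)))
    where
    part : Subset n → Fin n → Fin n → ℚ
    part C i j = [ lookup A i ] * [ lookup C j ] * f i j
    distrib : ∀ i j → part B i j ≡ part B₁ i j + part B₂ i j
    distrib i j rewrite split j =
      solve 4 (λ a x y w → a :* (x :+ y) :* w := a :* x :* w :+ a :* y :* w) refl
        [ lookup A i ] [ lookup B₁ j ] [ lookup B₂ j ] (f i j)

  cut-comm : (∀ i j → f i j ≡ f j i) → ∀ A B → cut f A B ≡ cut f B A
  cut-comm sym-f A B = trans (Σ-comm λ i j → [ lookup A i ] * [ lookup B j ] * f i j) (Σ-cong λ j → Σ-cong λ i →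
    trans (cong ([ lookup A i ] * [ lookup B j ] *_) (sym-f i j))
          (cong (_* f j i) (*-comm [ lookup A i ] [ lookup B j ])))

  cut-∖-∖ : (∀ i j → f i j ≡ f j i) → ∀ {S U} → S ⊆ U → cut f (U ∖ S) (U ∖ (U ∖ S)) ≡ cut f S (U ∖ S)
  cut-∖-∖ f-sym {S} {U} S⊆U = trans (cong (cut f (U ∖ S)) (∖-∖-⊆ S⊆U)) (cut-comm f-sym (U ∖ S) S)

  cut-nonNeg : (∀ i j → 0ℚ ≤ f i j) → ∀ A B → 0ℚ ≤ cut f A B
  cut-nonNeg 0≤f A B = Σ-nonNeg λ i → Σ-nonNeg λ j →
    *-nonNeg (*-nonNeg ([]-nonNeg (lookup A i)) ([]-nonNeg (lookup B j))) (0≤f i j)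

  vol-nonNeg : (∀ i j → 0ℚ ≤ f i j) → ∀ A → 0ℚ ≤ vol f A
  vol-nonNeg 0≤f A = Σ-nonNeg λ i → *-nonNeg ([]-nonNeg (lookup A i)) (Σ-nonNeg (0≤f i))

  cut≤vol : (∀ i j → 0ℚ ≤ f i j) → ∀ A B → cut f A B ≤ vol f A
  cut≤vol 0≤f A B = subst (_≤ vol f A) (sym (cut-by-rows A B)) (Σ-mono-≤ λ i →
    *-monoˡ-≤-0≤ ([]-nonNeg (lookup A i)) (Σ-mono-≤ λ j →
      subst ([ lookup B j ] * f i j ≤_) (*-identityˡ (f i j)) (*-monoʳ-≤-0≤ (0≤f i j) ([]≤1 (lookup B j)))))

  cut-⁅⁆-∁⁅⁆ : ∀ x → f x x ≡ 0ℚ → cut f ⁅ x ⁆ (∁ ⁅ x ⁆) ≡ Σ (f x)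
  cut-⁅⁆-∁⁅⁆ x fxx≡0 = begin
    cut f ⁅ x ⁆ (∁ ⁅ x ⁆)                   ≡⟨ cut-by-rows ⁅ x ⁆ (∁ ⁅ x ⁆) ⟩
    Σ (λ i → [ lookup ⁅ x ⁆ i ] * Σ λ j → [ lookup (∁ ⁅ x ⁆) j ] * f i j)
                                            ≡⟨ Σ-⁅⁆ x _ ⟩
    Σ outside                               ≡⟨ +-identityʳ (Σ outside) ⟨
    Σ outside + 0ℚ                          ≡⟨ cong (_+_ (Σ outside)) (trans (Σ-⁅⁆ x (f x)) fxx≡0) ⟨
    Σ outside + Σ inside                    ≡⟨ Σ-+ outside inside ⟨
    Σ (λ j → outside j + inside j)          ≡⟨ Σ-cong partition ⟩
    Σ (f x)                                 ∎
    where
    open ≡-Reasoning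
    outside inside : Fin n → ℚ
    outside j = [ lookup (∁ ⁅ x ⁆) j ] * f x j
    inside  j = [ lookup ⁅ x ⁆ j ] * f x j
    partition : ∀ j → outside j + inside j ≡ f x j
    partition j = begin
      outside j + inside j                                    ≡⟨ *-distribʳ-+ (f x j) [ lookup (∁ ⁅ x ⁆) j ] [ lookup ⁅ x ⁆ j ] ⟨
      ([ lookup (∁ ⁅ x ⁆) j ] + [ lookup ⁅ x ⁆ j ]) * f x j    ≡⟨ cong (λ t → ([ t ] + [ lookup ⁅ x ⁆ j ]) * f x j) (Vecₚ.lookup-map j not ⁅ x ⁆) ⟩
      ([ not (lookup ⁅ x ⁆ j) ] + [ lookup ⁅ x ⁆ j ]) * f x j  ≡⟨ cong (_* f x j) ([not]+[]≡1 (lookup ⁅ x ⁆ j)) ⟩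
      1ℚ * f x j                                              ≡⟨ *-identityˡ (f x j) ⟩
      f x j                                                   ∎

vol-≤-* : ∀ {n} (g h : Fin n → Fin n → ℚ) {k} → 0ℚ ≤ k → (∀ x → Σ (g x) ≤ k * Σ (h x)) →
  ∀ T → vol g T ≤ k * vol h T
vol-≤-* g h {k} 0≤k deg-g≤k·deg-h T = begin
  Σ (λ i → [ lookup T i ] * Σ (g i))        ≤⟨ Σ-mono-≤ (λ i → *-monoˡ-≤-0≤ ([]-nonNeg (lookup T i)) (deg-g≤k·deg-h i)) ⟩
  Σ (λ i → [ lookup T i ] * (k * Σ (h i)))  ≡⟨ Σ-cong (λ i → solve 3 (λ a k s → a :* (k :* s) := k :* (a :* s)) refl [ lookup T i ] k (Σ (h i))) ⟩
  Σ (λ i → k * ([ lookup T i ] * Σ (h i)))  ≡⟨ Σ-*ˡ k (λ i → [ lookup T i ] * Σ (h i)) ⟩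
  k * vol h T                               ∎
  where open ≤-Reasoning

adjacency : ∀ {n} → Graph n → Fin n → Fin n → ℚ
adjacency G i j = [ Graph.adj G i j ]

adjacency-nonNeg : ∀ {n} (G : Graph n) i j → 0ℚ ≤ adjacency G i j
adjacency-nonNeg G i j = []-nonNeg (Graph.adj G i j)

adjacency-sym : ∀ {n} (G : Graph n) i j → adjacency G i j ≡ adjacency G j i
adjacency-sym G i j = cong [_] (Graph.sym G i j)

weight-diagonal : ∀ {n} {G : Graph n} (H : WeightedSubgraph G) x → WeightedSubgraph.wt H x x ≡ 0ℚ
weight-diagonal {G = G} H x with WeightedSubgraph.wt H x x ≟ 0ℚ
... | yes wxx≡0 = wxx≡0
... | no wxx≢0 = contradiction (trans (sym (WeightedSubgraph.support H x x wxx≢0)) (Graph.irref G x)) λ ()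

module Sparsifier {n} {G : Graph n} {H : WeightedSubgraph G} {U : Subset n} {δ : ℚ}
                  (0≤δ : 0ℚ ≤ δ) (H≈G : H [ U ]≈[ δ ] G) where
  open WeightedSubgraph H using (wt; nonneg)

  -- The cut condition applied to singletons bounds every weighted degree.
  volH≤[1+δ]volG : ∀ T → volH H T ≤ (1ℚ + δ) * volG G T
  volH≤[1+δ]volG = vol-≤-* wt (adjacency G) (+-nonNeg (nonNegative⁻¹ 1ℚ) 0≤δ) degree-bound
    where
    degree-bound : ∀ x → Σ (wt x) ≤ (1ℚ + δ) * Σ (adjacency G x)
    degree-bound x = subst₂ (λ s t → s ≤ (1ℚ + δ) * t)
      (cut-⁅⁆-∁⁅⁆ wt x (weight-diagonal H x))
      (cut-⁅⁆-∁⁅⁆ (adjacency G) x (cong [_] (Graph.irref G x)))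
      (proj₂ (proj₂ H≈G ⁅ x ⁆))

  module _ {T : Subset n} (T⊆U : T ⊆ U) where
    private
      e o w w₀ : ℚ
      e  = eG G T (U ∖ T)
      o  = eG G T (∁ U)
      w  = wH H T (U ∖ T)
      w₀ = wH H T (∁ U)

    inner-cut-lower : e - δ * (e + o) ≤ w
    inner-cut-lower = ≤-by-difference
      (solve 4 (λ e o w δ → w :- (e :- δ :* (e :+ o)) := δ :* (e :+ o) :- (e :- w)) refl e o w δ)
      (begin
        e - w               ≡⟨ solve 2 (λ e w → e :- w := :- (w :- e)) refl e w ⟩
        - (w - e)           ≤⟨ -p≤∣p∣ (w - e) ⟩
        ∣ w - e ∣           ≤⟨ proj₁ H≈G T (⊆⇒lookup T⊆U) ⟩
        δ * eG G T (∁ T)    ≡⟨ cong (δ *_) (cut-splitʳ (adjacency G) T (∁ T) (U ∖ T) (∁ U) ([∁]-split T⊆U)) ⟩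
        δ * (e + o)         ∎)
      where open ≤-Reasoning

    outer-cut-upper : w₀ ≤ o + + 2 / 1 * δ * (e + o)
    outer-cut-upper = ≤-by-difference
      (solve 5 (λ e o w w₀ δ →
          (o :+ con (+ 2 / 1) :* δ :* (e :+ o)) :- w₀
        := ((con 1ℚ :+ δ) :* (e :+ o) :+ w) :- ((w :+ w₀) :+ (e :- δ :* (e :+ o))))
        refl e o w w₀ δ)
      (+-mono-≤ boundary-upper inner-cut-lower)
      where
      boundary-upper : w + w₀ ≤ (1ℚ + δ) * (e + o)
      boundary-upper = subst₂ (λ s t → s ≤ (1ℚ + δ) * t)
        (cut-splitʳ wt T (∁ T) (U ∖ T) (∁ U) ([∁]-split T⊆U))
        (cut-splitʳ (adjacency G) T (∁ T) (U ∖ T) (∁ U) ([∁]-split T⊆U))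
        (proj₂ (proj₂ H≈G T))

-- P is φ̂ and κ is (b - φ)/φ. For a side T: e = |E(T, U∖T)|, o = |E(T, V∖U)|, v = vol(T),
-- v₀ = vol_H(T), w₀ = w(T, V∖U), w = w(T, U∖T); Y is Φ°_{H,U}(S) and D its denominator.

module _ {P δ : ℚ} (0≤P : 0ℚ ≤ P) (0≤δ : 0ℚ ≤ δ) where

  H-volume-bound : ∀ {κ e o v v₀ w₀} → 0ℚ ≤ κ → 0ℚ ≤ e → 0ℚ ≤ v → P * (1ℚ + κ) ≤ 1ℚ →
    P * (v + κ * o) ≤ e → v₀ ≤ (1ℚ + δ) * v → w₀ ≤ o + + 2 / 1 * δ * (e + o) →
    P * (v₀ + κ * w₀) ≤ (1ℚ + + 4 / 1 * δ) * e
  H-volume-bound {κ} {e} {o} {v} {v₀} {w₀} 0≤κ 0≤e 0≤v P[1+κ]≤1 Pvol°≤e v₀≤ w₀≤ = begin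
    P * (v₀ + κ * w₀)
      ≤⟨ *-monoˡ-≤-0≤ 0≤P (+-mono-≤ v₀≤ (*-monoˡ-≤-0≤ 0≤κ w₀≤)) ⟩
    P * ((1ℚ + δ) * v + κ * (o + + 2 / 1 * δ * (e + o)))
      ≡⟨ solve 6 (λ P δ κ e o v →
             P :* ((con 1ℚ :+ δ) :* v :+ κ :* (o :+ con (+ 2 / 1) :* δ :* (e :+ o)))
          := (con 1ℚ :+ δ) :* (P :* (v :+ κ :* o)) :+ con (+ 2 / 1) :* δ :* (P :* κ :* e) :+ δ :* (P :* κ :* o))
          refl P δ κ e o v ⟩
    (1ℚ + δ) * (P * (v + κ * o)) + + 2 / 1 * δ * (P * κ * e) + δ * (P * κ * o)
      ≤⟨ +-mono-≤ (+-mono-≤ (*-monoˡ-≤-0≤ 0≤1+δ Pvol°≤e) (*-monoˡ-≤-0≤ 0≤2δ Pκe≤e)) (*-monoˡ-≤-0≤ 0≤δ Pκo≤e) ⟩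
    (1ℚ + δ) * e + + 2 / 1 * δ * e + δ * e
      ≡⟨ solve 2 (λ δ e → (con 1ℚ :+ δ) :* e :+ con (+ 2 / 1) :* δ :* e :+ δ :* e
                        := (con 1ℚ :+ con (+ 4 / 1) :* δ) :* e) refl δ e ⟩
    (1ℚ + + 4 / 1 * δ) * e ∎
    where
    open ≤-Reasoning
    0≤1+δ : 0ℚ ≤ 1ℚ + δ
    0≤1+δ = +-nonNeg (nonNegative⁻¹ 1ℚ) 0≤δ
    0≤2δ : 0ℚ ≤ + 2 / 1 * δ
    0≤2δ = *-nonNeg (nonNegative⁻¹ (+ 2 / 1)) 0≤δ
    Pκ≤1 : P * κ ≤ 1ℚ
    Pκ≤1 = ≤-trans (≤-by-difference (solve 2 (λ P κ → P :* (con 1ℚ :+ κ) :- P :* κ := P :- con 0ℚ) refl P κ) 0≤P)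
                   P[1+κ]≤1
    Pκe≤e : P * κ * e ≤ e
    Pκe≤e = subst (P * κ * e ≤_) (*-identityˡ e) (*-monoʳ-≤-0≤ 0≤e Pκ≤1)
    Pκo≤e : P * κ * o ≤ e
    Pκo≤e = ≤-trans (≤-by-difference (solve 4 (λ P κ o v → P :* (v :+ κ :* o) :- P :* κ :* o := P :* v :- con 0ℚ) refl P κ o v)
                                     (*-nonNeg 0≤P 0≤v))
                    Pvol°≤e

  conductance-lower : ∀ {Y D e o w b} → 0ℚ < e → 0ℚ ≤ b → 0ℚ ≤ Y →
    P * D ≤ (1ℚ + + 4 / 1 * δ) * e → Y * D ≡ w → e - δ * (e + o) ≤ w → b * o ≤ e →
    P * (b - b * δ - δ) ≤ b * Y * (1ℚ + + 4 / 1 * δ)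
  conductance-lower {Y} {D} {e} {o} {w} {b} 0<e 0≤b 0≤Y PD≤ YD≡w e-δ[e+o]≤w bo≤e =
    *-cancelˡ-≤-0< 0<e (begin
      e * (P * (b - b * δ - δ))
        ≡⟨ solve 5 (λ P δ e o b → e :* (P :* (b :- b :* δ :- δ))
                  := b :* P :* (e :- δ :* (e :+ o)) :+ P :* δ :* (b :* o) :- P :* δ :* e) refl P δ e o b ⟩
      b * P * (e - δ * (e + o)) + P * δ * (b * o) - P * δ * e
        ≤⟨ +-monoˡ-≤ (- (P * δ * e)) (+-mono-≤ (*-monoˡ-≤-0≤ (*-nonNeg 0≤b 0≤P) e-δ[e+o]≤w)
                                               (*-monoˡ-≤-0≤ (*-nonNeg 0≤P 0≤δ) bo≤e)) ⟩
      b * P * w + P * δ * e - P * δ * e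
        ≡⟨ cong (λ t → b * P * t + P * δ * e - P * δ * e) YD≡w ⟨
      b * P * (Y * D) + P * δ * e - P * δ * e
        ≡⟨ solve 6 (λ P δ e b Y D → b :* P :* (Y :* D) :+ P :* δ :* e :- P :* δ :* e := b :* Y :* (P :* D))
             refl P δ e b Y D ⟩
      b * Y * (P * D)
        ≤⟨ *-monoˡ-≤-0≤ (*-nonNeg 0≤b 0≤Y) PD≤ ⟩
      b * Y * ((1ℚ + + 4 / 1 * δ) * e)
        ≡⟨ solve 4 (λ δ e b Y → b :* Y :* ((con 1ℚ :+ con (+ 4 / 1) :* δ) :* e)
                  := e :* (b :* Y :* (con 1ℚ :+ con (+ 4 / 1) :* δ))) refl δ e b Y ⟩
      e * (b * Y * (1ℚ + + 4 / 1 * δ)) ∎)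
    where open ≤-Reasoning

  conductance-loss : ∀ {Y b} → 0ℚ ≤ b → b ≤ 1ℚ →
    P * (b - b * δ - δ) ≤ b * Y * (1ℚ + + 4 / 1 * δ) → b * (P - Y) ≤ + 6 / 1 * (P * δ)
  conductance-loss {Y} {b} 0≤b b≤1 lower with ≤-total Y P
  ... | inj₂ P≤Y = ≤-trans
    (≤-by-difference (solve 3 (λ b P Y → con 0ℚ :- b :* (P :- Y) := b :* (Y :- P) :- con 0ℚ) refl b P Y)
                     (*-nonNeg 0≤b (≤⇒0≤- P≤Y)))
    (*-nonNeg (nonNegative⁻¹ (+ 6 / 1)) (*-nonNeg 0≤P 0≤δ))
  ... | inj₁ Y≤P = begin
    b * (P - Y)
      ≤⟨ ≤-by-difference (solve 3 (λ b δ d → b :* d :* (con 1ℚ :+ con (+ 4 / 1) :* δ) :- b :* d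
                                          := con (+ 4 / 1) :* δ :* (b :* d) :- con 0ℚ) refl b δ (P - Y))
                         (*-nonNeg (*-nonNeg (nonNegative⁻¹ (+ 4 / 1)) 0≤δ) (*-nonNeg 0≤b (≤⇒0≤- Y≤P))) ⟩
    b * (P - Y) * (1ℚ + + 4 / 1 * δ)
      ≡⟨ solve 4 (λ b δ P Y → b :* (P :- Y) :* (con 1ℚ :+ con (+ 4 / 1) :* δ)
                := b :* P :* (con 1ℚ :+ con (+ 4 / 1) :* δ) :- b :* Y :* (con 1ℚ :+ con (+ 4 / 1) :* δ)) refl b δ P Y ⟩
    b * P * (1ℚ + + 4 / 1 * δ) - b * Y * (1ℚ + + 4 / 1 * δ)
      ≤⟨ +-monoʳ-≤ (b * P * (1ℚ + + 4 / 1 * δ)) (neg-antimono-≤ lower) ⟩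
    b * P * (1ℚ + + 4 / 1 * δ) - P * (b - b * δ - δ)
      ≡⟨ solve 3 (λ b δ P → b :* P :* (con 1ℚ :+ con (+ 4 / 1) :* δ) :- P :* (b :- b :* δ :- δ)
                := P :* δ :* (con (+ 5 / 1) :* b :+ con 1ℚ)) refl b δ P ⟩
    P * δ * (+ 5 / 1 * b + 1ℚ)
      ≤⟨ *-monoˡ-≤-0≤ (*-nonNeg 0≤P 0≤δ) (+-monoˡ-≤ 1ℚ (*-monoˡ-≤-0≤ (nonNegative⁻¹ (+ 5 / 1)) b≤1)) ⟩
    P * δ * (+ 6 / 1)
      ≡⟨ *-comm (P * δ) (+ 6 / 1) ⟩
    + 6 / 1 * (P * δ) ∎
    where open ≤-Reasoning

  loss-times-c²b : ∀ {Y b c} → 0ℚ ≤ c → c ≤ + 1 / 6 → b * (P - Y) ≤ + 6 / 1 * (P * δ) →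
    + 3 / 1 * (P - Y) * (c * c * b) ≤ δ * P
  loss-times-c²b {Y} {b} {c} 0≤c c≤1/6 loss = begin
    + 3 / 1 * (P - Y) * (c * c * b)
      ≡⟨ solve 4 (λ P Y b c → con (+ 3 / 1) :* (P :- Y) :* (c :* c :* b) := con (+ 3 / 1) :* (c :* c) :* (b :* (P :- Y)))
           refl P Y b c ⟩
    + 3 / 1 * (c * c) * (b * (P - Y))
      ≤⟨ *-monoˡ-≤-0≤ (*-nonNeg (nonNegative⁻¹ (+ 3 / 1)) (*-nonNeg 0≤c 0≤c)) loss ⟩
    + 3 / 1 * (c * c) * (+ 6 / 1 * (P * δ))
      ≡⟨ solve 3 (λ P δ c → con (+ 3 / 1) :* (c :* c) :* (con (+ 6 / 1) :* (P :* δ)) := con (+ 18 / 1) :* (P :* δ) :* (c :* c))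
           refl P δ c ⟩
    + 18 / 1 * (P * δ) * (c * c)
      ≤⟨ *-monoˡ-≤-0≤ (*-nonNeg (nonNegative⁻¹ (+ 18 / 1)) 0≤Pδ) c²≤1/36 ⟩
    + 18 / 1 * (P * δ) * (+ 1 / 36)
      ≤⟨ ≤-by-difference (solve 2 (λ P δ → δ :* P :- con (+ 18 / 1) :* (P :* δ) :* con (+ 1 / 36) := con (+ 1 / 2) :* (P :* δ) :- con 0ℚ)
                           refl P δ)
                         (*-nonNeg (nonNegative⁻¹ (+ 1 / 2)) 0≤Pδ) ⟩
    δ * P ∎
    where
    open ≤-Reasoning
    0≤Pδ : 0ℚ ≤ P * δ
    0≤Pδ = *-nonNeg 0≤P 0≤δ
    c²≤1/36 : c * c ≤ + 1 / 36
    c²≤1/36 = ≤-trans (*-monoˡ-≤-0≤ 0≤c c≤1/6) (*-monoʳ-≤-0≤ (nonNegative⁻¹ (+ 1 / 6)) c≤1/6)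

-- Defs keeps κ private; this is the same term.
κ : ℚ → ℚ → ℚ
κ b φ = (b - φ) ÷₀ φ

module _ {b φ : ℚ} (0<φ : 0ℚ < φ) (φ≤b : φ ≤ b) where

  κ-nonNeg : 0ℚ ≤ κ b φ
  κ-nonNeg = ÷₀-nonNeg (≤⇒0≤- φ≤b) (<⇒≤ 0<φ)

  φ[1+κ]≡b : φ * (1ℚ + κ b φ) ≡ b
  φ[1+κ]≡b = begin
    φ * (1ℚ + κ b φ)  ≡⟨ solve 2 (λ φ κ → φ :* (con 1ℚ :+ κ) := φ :+ κ :* φ) refl φ (κ b φ) ⟩
    φ + κ b φ * φ     ≡⟨ cong (_+_ φ) (÷₀-*-inverse (b - φ) φ λ φ≡0 → ⊥-elim (<⇒≢ 0<φ (sym φ≡0))) ⟩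
    φ + (b - φ)       ≡⟨ solve 2 (λ φ b → φ :+ (b :- φ) := b) refl φ b ⟩
    b                 ∎
    where open ≡-Reasoning

  b≤P[1+κ] : ∀ {P} → φ ≤ P → b ≤ P * (1ℚ + κ b φ)
  b≤P[1+κ] {P} φ≤P = subst (_≤ P * (1ℚ + κ b φ)) φ[1+κ]≡b
    (*-monoʳ-≤-0≤ (+-nonNeg (nonNegative⁻¹ 1ℚ) κ-nonNeg) φ≤P)

  P[1+κ]≤1 : ∀ {P} → P ≤ φ ÷₀ b → P * (1ℚ + κ b φ) ≤ 1ℚ
  P[1+κ]≤1 {P} P≤φ/b = *-cancelˡ-≤-0< 0<φ (begin
    φ * (P * (1ℚ + κ b φ))  ≡⟨ solve 3 (λ φ P κ → φ :* (P :* (con 1ℚ :+ κ)) := P :* (φ :* (con 1ℚ :+ κ))) refl φ P (κ b φ) ⟩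
    P * (φ * (1ℚ + κ b φ))  ≡⟨ cong (P *_) φ[1+κ]≡b ⟩
    P * b                   ≤⟨ ≤÷₀⇒*≤ P≤φ/b (<-≤-trans 0<φ φ≤b) ⟩
    φ                       ≡⟨ *-identityʳ φ ⟨
    φ * 1ℚ                  ∎)
    where open ≤-Reasoning

module Conductance {n} {b φ φ̂ δ : ℚ} {G : Graph n} {U : Subset n} {H : WeightedSubgraph G}
  (0<φ : 0ℚ < φ) (φ≤b : φ ≤ b) (b≤1 : b ≤ 1ℚ) (φ≤φ̂ : φ ≤ φ̂) (φ̂≤φ/b : φ̂ ≤ φ ÷₀ b)
  (0≤δ : 0ℚ ≤ δ) (H≈G : H [ U ]≈[ δ ] G) where

  open Sparsifier {H = H} {U = U} 0≤δ H≈G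
  open WeightedSubgraph H using (wt; nonneg) renaming (sym to wt-sym)

  private
    0<φ̂ : 0ℚ < φ̂
    0<φ̂ = <-≤-trans 0<φ φ≤φ̂
    0≤φ̂ : 0ℚ ≤ φ̂
    0≤φ̂ = <⇒≤ 0<φ̂
    0≤b : 0ℚ ≤ b
    0≤b = ≤-trans (<⇒≤ 0<φ) φ≤b

  vol°-nonNeg : ∀ T → 0ℚ ≤ vol° b φ G U T
  vol°-nonNeg T = +-nonNeg (vol-nonNeg (adjacency G) (adjacency-nonNeg G) T)
                           (*-nonNeg (κ-nonNeg 0<φ φ≤b) (cut-nonNeg (adjacency G) (adjacency-nonNeg G) T (∁ U)))

  wH≤volH° : ∀ T B → wH H T B ≤ volH° b φ G U H T
  wH≤volH° T B = ≤-trans (cut≤vol wt nonneg T B)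
    (≤-by-difference (solve 2 (λ v x → (v :+ x) :- v := x :- con 0ℚ) refl (volH H T) (κ b φ * wH H T (∁ U)))
                     (*-nonNeg (κ-nonNeg 0<φ φ≤b) (cut-nonNeg wt nonneg T (∁ U))))

  side-conductance-lower : ∀ {T Y D} → T ⊆ U → 0ℚ < eG G T (U ∖ T) →
    φ̂ * vol° b φ G U T ≤ eG G T (U ∖ T) → D ≤ volH° b φ G U H T → 0ℚ ≤ Y → Y * D ≡ wH H T (U ∖ T) →
    φ̂ * (b - b * δ - δ) ≤ b * Y * (1ℚ + + 4 / 1 * δ)
  side-conductance-lower {T} {Y} {D} T⊆U 0<e φ̂vol°≤e D≤volH° 0≤Y YD≡w =
    conductance-lower 0≤φ̂ 0≤δ 0<e 0≤b 0≤Y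
      (≤-trans (*-monoˡ-≤-0≤ 0≤φ̂ D≤volH°)
               (H-volume-bound 0≤φ̂ 0≤δ (κ-nonNeg 0<φ φ≤b) (<⇒≤ 0<e) (vol-nonNeg (adjacency G) (adjacency-nonNeg G) T)
                  (P[1+κ]≤1 0<φ φ≤b φ̂≤φ/b) φ̂vol°≤e (volH≤[1+δ]volG T) (outer-cut-upper T⊆U)))
      YD≡w (inner-cut-lower T⊆U) bo≤e
    where
    o v e : ℚ
    o = eG G T (∁ U)
    v = volG G T
    e = eG G T (U ∖ T)
    bo≤e : b * o ≤ e
    bo≤e = begin
      b * o                  ≤⟨ *-monoʳ-≤-0≤ (cut-nonNeg (adjacency G) (adjacency-nonNeg G) T (∁ U)) (b≤P[1+κ] 0<φ φ≤b φ≤φ̂) ⟩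
      φ̂ * (1ℚ + κ b φ) * o   ≡⟨ solve 3 (λ P κ o → P :* (con 1ℚ :+ κ) :* o := P :* (o :+ κ :* o)) refl φ̂ (κ b φ) o ⟩
      φ̂ * (o + κ b φ * o)    ≤⟨ *-monoˡ-≤-0≤ 0≤φ̂ (+-monoˡ-≤ (κ b φ * o) (cut≤vol (adjacency G) (adjacency-nonNeg G) T (∁ U))) ⟩
      φ̂ * (v + κ b φ * o)    ≤⟨ φ̂vol°≤e ⟩
      e                      ∎
      where open ≤-Reasoning

  ≤Φ°⇒≤cut : ∀ {S} → φ̂ ≤ Φ° b φ G U S →
    0ℚ < eG G S (U ∖ S) × φ̂ * (vol° b φ G U S ⊓ vol° b φ G U (U ∖ S)) ≤ eG G S (U ∖ S)
  ≤Φ°⇒≤cut {S} φ̂≤Φ° = <-≤-trans (*-pos 0<φ̂ 0<D) φ̂D≤e , φ̂D≤e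
    where
    0<D : 0ℚ < vol° b φ G U S ⊓ vol° b φ G U (U ∖ S)
    0<D = 0≤∧≢0⇒0< (⊓-glb (vol°-nonNeg S) (vol°-nonNeg (U ∖ S))) (0<≤÷₀⇒≢0 0<φ̂ φ̂≤Φ°)
    φ̂D≤e : φ̂ * (vol° b φ G U S ⊓ vol° b φ G U (U ∖ S)) ≤ eG G S (U ∖ S)
    φ̂D≤e = ≤÷₀⇒*≤ φ̂≤Φ° 0<D

  module _ {S : Subset n} (S⊆U : S ⊆ U) where
    private
      w D : ℚ
      w = wH H S (U ∖ S)
      D = volH° b φ G U H S ⊓ volH° b φ G U H (U ∖ S)
      0≤w : 0ℚ ≤ w
      0≤w = cut-nonNeg wt nonneg S (U ∖ S)

    wH≤ΦH°-denominator : w ≤ D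
    wH≤ΦH°-denominator = ⊓-glb (wH≤volH° S (U ∖ S))
      (subst (_≤ volH° b φ G U H (U ∖ S)) (cut-∖-∖ wt wt-sym S⊆U) (wH≤volH° (U ∖ S) (U ∖ (U ∖ S))))

    ΦH°-nonNeg : 0ℚ ≤ ΦH° b φ G U H S
    ΦH°-nonNeg = ÷₀-nonNeg 0≤w (≤-trans 0≤w wH≤ΦH°-denominator)

    -- w ≤ D also covers D = 0, where ÷₀ returns its junk value 0.
    ΦH°-*-denominator : ΦH° b φ G U H S * D ≡ w
    ΦH°-*-denominator = ÷₀-*-inverse w D λ D≡0 → ≤-antisym (subst (w ≤_) D≡0 wH≤ΦH°-denominator) 0≤w

  sparsified-loss : ∀ {S} → S ⊆ U → φ̂ ≤ Φ° b φ G U S → b * (φ̂ - ΦH° b φ G U H S) ≤ + 6 / 1 * (φ̂ * δ)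
  sparsified-loss {S} S⊆U φ̂≤Φ° =
    conductance-loss 0≤φ̂ 0≤δ 0≤b b≤1 (minimal-side (⊓-sel (vol° b φ G U S) (vol° b φ G U S′)))
    where
    S′ : Subset n
    S′ = U ∖ S
    D : ℚ
    D = vol° b φ G U S ⊓ vol° b φ G U S′
    e′≡e : eG G S′ (U ∖ S′) ≡ eG G S S′
    e′≡e = cut-∖-∖ (adjacency G) (adjacency-sym G) S⊆U
    0<e : 0ℚ < eG G S S′
    0<e = proj₁ (≤Φ°⇒≤cut φ̂≤Φ°)
    φ̂D≤e : φ̂ * D ≤ eG G S S′
    φ̂D≤e = proj₂ (≤Φ°⇒≤cut φ̂≤Φ°)
    minimal-side : D ≡ vol° b φ G U S ⊎ D ≡ vol° b φ G U S′ →
      φ̂ * (b - b * δ - δ) ≤ b * ΦH° b φ G U H S * (1ℚ + + 4 / 1 * δ)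
    minimal-side (inj₁ D≡vol°S) =
      side-conductance-lower S⊆U 0<e (subst (λ t → φ̂ * t ≤ eG G S S′) D≡vol°S φ̂D≤e)
        (p⊓q≤p (volH° b φ G U H S) (volH° b φ G U H S′)) (ΦH°-nonNeg S⊆U) (ΦH°-*-denominator S⊆U)
    minimal-side (inj₂ D≡vol°S′) =
      side-conductance-lower (p∩q⊆p U (∁ S)) (subst (0ℚ <_) (sym e′≡e) 0<e)
        (subst₂ (λ t e → φ̂ * t ≤ e) D≡vol°S′ (sym e′≡e) φ̂D≤e)
        (p⊓q≤q (volH° b φ G U H S) (volH° b φ G U H S′)) (ΦH°-nonNeg S⊆U)
        (trans (ΦH°-*-denominator S⊆U) (sym (cut-∖-∖ wt wt-sym S⊆U)))

module ℕ-*ₚ = CommutativeSemigroupₚ ℕ.*-commutativeSemigroup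
module ℤ-*ₚ = CommutativeSemigroupₚ ℤ.*-commutativeSemigroup

pos-* : ∀ k A → pos (+ k ℤ.* A) ≡ k ℕ.* pos A
pos-* ℕ.zero    A        = refl
pos-* (ℕ.suc k) (+ a)    = cong pos (ℤ.+◃n≡+n (ℕ.suc k ℕ.* a))
pos-* (ℕ.suc k) -[1+ a ] = sym (ℕ.*-zeroʳ (ℕ.suc k))

neg-* : ∀ k A → neg (+ k ℤ.* A) ≡ k ℕ.* neg A
neg-* ℕ.zero    A        = refl
neg-* (ℕ.suc k) (+ a)    = trans (cong neg (ℤ.+◃n≡+n (ℕ.suc k ℕ.* a))) (sym (ℕ.*-zeroʳ (ℕ.suc k)))
neg-* (ℕ.suc k) -[1+ a ] = refl

^-distrib-* : ∀ x y k → (x ℕ.* y) ℕ.^ k ≡ x ℕ.^ k ℕ.* y ℕ.^ k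
^-distrib-* x y ℕ.zero    = refl
^-distrib-* x y (ℕ.suc k) = begin
  x ℕ.* y ℕ.* (x ℕ.* y) ℕ.^ k             ≡⟨ cong (x ℕ.* y ℕ.*_) (^-distrib-* x y k) ⟩
  x ℕ.* y ℕ.* (x ℕ.^ k ℕ.* y ℕ.^ k)       ≡⟨ ℕ-*ₚ.interchange x y (x ℕ.^ k) (y ℕ.^ k) ⟩
  x ℕ.* x ℕ.^ k ℕ.* (y ℕ.* y ℕ.^ k)       ∎
  where open ≡-Reasoning

^-pos-neg-scale : ∀ x y k A C →
  x ℕ.^ pos (+ k ℤ.* A) ℕ.* y ℕ.^ neg (+ k ℤ.* C) ≡ (x ℕ.^ pos A ℕ.* y ℕ.^ neg C) ℕ.^ k
^-pos-neg-scale x y k A C rewrite pos-* k A | neg-* k C = begin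
  x ℕ.^ (k ℕ.* pos A) ℕ.* y ℕ.^ (k ℕ.* neg C)       ≡⟨ cong₂ ℕ._*_ (^-*-swap x (pos A)) (^-*-swap y (neg C)) ⟩
  (x ℕ.^ pos A) ℕ.^ k ℕ.* (y ℕ.^ neg C) ℕ.^ k       ≡⟨ ^-distrib-* (x ℕ.^ pos A) (y ℕ.^ neg C) k ⟨
  (x ℕ.^ pos A ℕ.* y ℕ.^ neg C) ℕ.^ k               ∎
  where
  open ≡-Reasoning
  ^-*-swap : ∀ z m → z ℕ.^ (k ℕ.* m) ≡ (z ℕ.^ m) ℕ.^ k
  ^-*-swap z m = trans (cong (z ℕ.^_) (ℕ.*-comm k m)) (sym (ℕ.^-*-assoc z m k))

PowLe-scale : ∀ n k A C → PowLe n A C → PowLe n (+ k ℤ.* A) (+ k ℤ.* C)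
PowLe-scale n k A C h =
  subst₂ ℕ._≤_ (sym (^-pos-neg-scale n 2 k A C)) (sym (^-pos-neg-scale 2 n k C A)) (ℕ.^-monoˡ-≤ k h)

PowLe-unscale : ∀ n k A C → PowLe n (+ ℕ.suc k ℤ.* A) (+ ℕ.suc k ℤ.* C) → PowLe n A C
PowLe-unscale n k A C h with (n ℕ.^ pos A ℕ.* 2 ℕ.^ neg C) ℕ.≤? (2 ℕ.^ pos C ℕ.* n ℕ.^ neg A)
... | yes h′ = h′
... | no ¬h′ = contradiction
  (subst₂ ℕ._≤_ (^-pos-neg-scale n 2 (ℕ.suc k) A C) (^-pos-neg-scale 2 n (ℕ.suc k) C A) h)
  (ℕ.<⇒≱ (ℕ.^-monoˡ-< (ℕ.suc k) (ℕ.≰⇒> ¬h′)))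

≤⇒pos+neg≤pos+neg : ∀ {A′ A} → A′ ℤ.≤ A → pos A′ ℕ.+ neg A ℕ.≤ pos A ℕ.+ neg A′
≤⇒pos+neg≤pos+neg (ℤ.-≤- k≤m)        = ℕ.s≤s k≤m
≤⇒pos+neg≤pos+neg ℤ.-≤+              = ℕ.z≤n
≤⇒pos+neg≤pos+neg (ℤ.+≤+ m≤k)        = ℕ.+-monoˡ-≤ 0 m≤k

PowLe-antimonoˡ : ∀ {n} .{{_ : ℕ.NonZero n}} {A′ A C} → A′ ℤ.≤ A → PowLe n A C → PowLe n A′ C
PowLe-antimonoˡ {n} {A′} {A} {C} A′≤A h = ℕ.*-cancelʳ-≤ _ _ (n ℕ.^ neg A) {{ℕ.m^n≢0 n (neg A)}} (begin
  n ℕ.^ pos A′ ℕ.* 2 ℕ.^ neg C ℕ.* n ℕ.^ neg A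
    ≡⟨ ℕ-*ₚ.xy∙z≈xz∙y (n ℕ.^ pos A′) (2 ℕ.^ neg C) (n ℕ.^ neg A) ⟩
  n ℕ.^ pos A′ ℕ.* n ℕ.^ neg A ℕ.* 2 ℕ.^ neg C
    ≡⟨ cong (ℕ._* 2 ℕ.^ neg C) (ℕ.^-distribˡ-+-* n (pos A′) (neg A)) ⟨
  n ℕ.^ (pos A′ ℕ.+ neg A) ℕ.* 2 ℕ.^ neg C
    ≤⟨ ℕ.*-monoˡ-≤ (2 ℕ.^ neg C) (ℕ.^-monoʳ-≤ n (≤⇒pos+neg≤pos+neg A′≤A)) ⟩
  n ℕ.^ (pos A ℕ.+ neg A′) ℕ.* 2 ℕ.^ neg C
    ≡⟨ cong (ℕ._* 2 ℕ.^ neg C) (ℕ.^-distribˡ-+-* n (pos A) (neg A′)) ⟩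
  n ℕ.^ pos A ℕ.* n ℕ.^ neg A′ ℕ.* 2 ℕ.^ neg C
    ≡⟨ ℕ-*ₚ.xy∙z≈xz∙y (n ℕ.^ pos A) (n ℕ.^ neg A′) (2 ℕ.^ neg C) ⟩
  n ℕ.^ pos A ℕ.* 2 ℕ.^ neg C ℕ.* n ℕ.^ neg A′
    ≤⟨ ℕ.*-monoˡ-≤ (n ℕ.^ neg A′) h ⟩
  2 ℕ.^ pos C ℕ.* n ℕ.^ neg A ℕ.* n ℕ.^ neg A′
    ≡⟨ ℕ-*ₚ.xy∙z≈xz∙y (2 ℕ.^ pos C) (n ℕ.^ neg A) (n ℕ.^ neg A′) ⟩
  2 ℕ.^ pos C ℕ.* n ℕ.^ neg A′ ℕ.* n ℕ.^ neg A ∎)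
  where open ℕ.≤-Reasoning

-- With a = p/q, c = r/s, a′ = p′/q′, c′ = r′/s′, the hypothesis is n^(ps) ≤ 2^(rq): raise it to the
-- power r′q′, trade exponents using p′r q s′ ≤ p r′ q′ s, and take the (rq)-th root.
·log₂-rescale : ∀ {n} .{{_ : ℕ.NonZero n}} {a c a′ c′} → 0ℚ < c → 0ℚ < c′ →
  a′ * c ≤ a * c′ → a ·log₂ n ≤ c → a′ ·log₂ n ≤ c′
·log₂-rescale {n} {a@(mkℚ p q-1 _)} {c@(mkℚ +[1+ r-1 ] s-1 _)} {a′@(mkℚ p′ q′-1 _)} {c′@(mkℚ +[1+ r′-1 ] s′-1 _)}
  _ _ a′c≤ac′ a·log≤c =
  PowLe-unscale n (q-1 ℕ.+ r-1 ℕ.* ℕ.suc q-1) (p′ ℤ.* s′) (r′ ℤ.* q′)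
    (subst (PowLe n (r ℤ.* q ℤ.* (p′ ℤ.* s′))) (ℤ.*-comm (r′ ℤ.* q′) (r ℤ.* q))
      (PowLe-antimonoˡ {C = r′ ℤ.* q′ ℤ.* (r ℤ.* q)} exponents (PowLe-scale n (ℕ.suc r′-1 ℕ.* ℕ.suc q′-1) (p ℤ.* s) (r ℤ.* q) a·log≤c)))
  where
  q s q′ s′ r r′ : ℤ.ℤ
  q = +[1+ q-1 ] ; s = +[1+ s-1 ] ; q′ = +[1+ q′-1 ] ; s′ = +[1+ s′-1 ]
  r = +[1+ r-1 ] ; r′ = +[1+ r′-1 ]
  cross : (p′ ℤ.* r) ℤ.* (q ℤ.* s′) ℤ.≤ (p ℤ.* r′) ℤ.* (q′ ℤ.* s)
  cross = ℚᵘ.drop-*≤* (ℚᵘ.≤-respʳ-≃ (toℚᵘ-homo-* a c′) (ℚᵘ.≤-respˡ-≃ (toℚᵘ-homo-* a′ c) (toℚᵘ-mono-≤ a′c≤ac′)))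
  exponents : r ℤ.* q ℤ.* (p′ ℤ.* s′) ℤ.≤ r′ ℤ.* q′ ℤ.* (p ℤ.* s)
  exponents = subst₂ ℤ._≤_ (regroup p′ r q s′) (regroup p r′ q′ s) cross
    where
    regroup : ∀ x y z t → (x ℤ.* y) ℤ.* (z ℤ.* t) ≡ (y ℤ.* z) ℤ.* (x ℤ.* t)
    regroup x y z t = trans (cong (ℤ._* (z ℤ.* t)) (ℤ.*-comm x y)) (ℤ-*ₚ.interchange y x z t)
·log₂-rescale {c = mkℚ (+ 0) _ _} (*<* (ℤ.+<+ ())) _ _ _
·log₂-rescale {c = mkℚ -[1+ _ ] _ _} (*<* ()) _ _ _
·log₂-rescale {c = mkℚ +[1+ _ ] _ _} {c′ = mkℚ (+ 0) _ _} _ (*<* (ℤ.+<+ ())) _ _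
·log₂-rescale {c = mkℚ +[1+ _ ] _ _} {c′ = mkℚ -[1+ _ ] _ _} _ (*<* ()) _ _

lemma5p9 : (b φ φ̂ c δ : ℚ) →
    (0ℚ < b × b < 1ℚ) → (0ℚ < φ × φ < 1ℚ) → (0ℚ < φ̂ × φ̂ < 1ℚ) →
    (0ℚ < c × c < 1ℚ) → (0ℚ < δ × δ < 1ℚ) →
    c ≤ + 1 / 6 → φ ≤ b → b ≤ c → φ ≤ φ̂ → φ̂ ≤ φ ÷₀ b →
    (n : ℕ) →
    -- δ ≤ c² b / log₂ n
    δ ·log₂ n ≤ (c * c * b) →
    (G : Graph n) (U : Subset n) (H : WeightedSubgraph G) →
    H [ U ]≈[ δ ] G →
    (S : Subset n) → Nonempty S → S ⊂ U →
    φ̂ ≤ Φ° b φ G U S →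
    -- Φ°_{H,U}(S) ≥ (1 - 1/(3 log₂ n)) φ̂ , i.e. 3 (φ̂ - Φ°_{H,U}(S)) log₂ n ≤ φ̂
    (+ 3 / 1 * (φ̂ - ΦH° b φ G U H S)) ·log₂ n ≤ φ̂
lemma5p9 b φ φ̂ c δ (0<b , b<1) (0<φ , _) (0<φ̂ , _) (0<c , _) (0<δ , _) c≤1/6 φ≤b _ φ≤φ̂ φ̂≤φ/b
         n δ·log≤c²b G U H H≈G S (x , _) (S⊆U , _) φ̂≤Φ° =
  ·log₂-rescale {{nonZeroIndex x}} {a = δ} {a′ = + 3 / 1 * (φ̂ - ΦH° b φ G U H S)} (*-pos (*-pos 0<c 0<c) 0<b) 0<φ̂
    (loss-times-c²b (<⇒≤ 0<φ̂) (<⇒≤ 0<δ) (<⇒≤ 0<c) c≤1/6 (sparsified-loss S⊆U φ̂≤Φ°))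
    δ·log≤c²b
  where open Conductance {G = G} {U = U} {H = H} 0<φ φ≤b (<⇒≤ b<1) φ≤φ̂ φ̂≤φ/b (<⇒≤ 0<δ) H≈G
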